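{- Let $r \ge 4$ and $t \ge 3$ be integers with $r \le 2t-2$. Then $\mathcal{C}(r,t)$ is the circuit set of a rank-$r$ sparse paving matroid on ground set $[2t+2]$.
   Context: For $i=1,\dots,t$ let $C_i\subseteq[2t]$ be the set of the $r-2$ consecutive integers $2i-1, 2i, \dots, 2i+r-4$, each reduced modulo $2t$ to a representative in $\{1,\dots,2t\}$. Let $X=\{2t+1,2t+2\}$, $\mathcal{C}'(r,t) = \{C_i\cup X : i\in[t]\}$, and $\mathcal{C}''(r,t) = \{C_i\cup C_{i+1} : i\in[t-1]\}$. Then $\mathcal{C}(r,t)$ is the collection of subsets of $[2t+2]$ consisting of all sets in $\mathcal{C}'(r,t)\cup\mathcal{C}''(r,t)$ together with all $(r+1)$-element subsets of $[2t+2]$ that contain no member of $\mathcal{C}'(r,t)\cup\mathcal{C}''(r,t)$. A matroid of rank $r$ is sparse paving if every $r$-element subset of its ground set is either a basis or a circuit-hyperplane. -}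

module Defs where

open import Data.Nat using (ℕ; zero; suc; _+_; _*_; _∸_; _≤_; _<_; _≡ᵇ_; _%_)
open import Data.Bool using (Bool; _∨_)
open import Data.Fin using (Fin; toℕ)
open import Data.Fin.Subset using (Subset; _∈_; _∉_; _⊆_; _∪_; _∩_; _-_; ∣_∣; ⁅_⁆; ⊥)
open import Data.List using (upTo)
open import Data.Bool.ListAction using (any)
open import Data.Vec using (tabulate)
open import Data.Product using (Σ; ∃; _×_)
open import Data.Sum using (_⊎_)
open import Relation.Nullary using (¬_)
open import Relation.Binary.PropositionalEquality using (_≡_)

module _ {n : ℕ} (𝒞 : Subset n → Set) where

  record IsCircuitSet : Set where
    field
      C1 : ¬ 𝒞 ⊥
      C2 : ∀ A B → 𝒞 A → 𝒞 B → A ⊆ B → A ≡ B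
      C3 : ∀ A B → 𝒞 A → 𝒞 B → ¬ A ≡ B → ∀ e → e ∈ A → e ∈ B →
           ∃ λ D → 𝒞 D × D ⊆ ((A ∪ B) - e)

  Independent : Subset n → Set
  Independent I = ∀ C → 𝒞 C → ¬ C ⊆ I

  HasRankOf : Subset n → ℕ → Set
  HasRankOf X k = (∃ λ I → I ⊆ X × Independent I × ∣ I ∣ ≡ k)
                × (∀ I → I ⊆ X → Independent I → ∣ I ∣ ≤ k)

  MatroidRank : ℕ → Set
  MatroidRank r = (∃ λ I → Independent I × ∣ I ∣ ≡ r)
                × (∀ I → Independent I → ∣ I ∣ ≤ r)

  IsBasis : Subset n → Set
  IsBasis B = Independent B × (∀ e → e ∉ B → ¬ Independent (B ∪ ⁅ e ⁆))

  IsFlat : Subset n → Set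
  IsFlat F = ∀ e → e ∉ F → ∀ k → HasRankOf F k → HasRankOf (F ∪ ⁅ e ⁆) (suc k)

  IsHyperplane : ℕ → Subset n → Set
  IsHyperplane r H = IsFlat H × HasRankOf H (r ∸ 1)

  IsCircuitHyperplane : ℕ → Subset n → Set
  IsCircuitHyperplane r H = 𝒞 H × IsHyperplane r H

  SparsePaving : ℕ → Set
  SparsePaving r = ∀ S → ∣ S ∣ ≡ r → IsBasis S ⊎ IsCircuitHyperplane r S

  IsRankSparsePavingCircuitSet : ℕ → Set
  IsRankSparsePavingCircuitSet r = IsCircuitSet × MatroidRank r × SparsePaving r

-- The family 𝒞(r,t) on [2t+2].  Element x ∈ [2t+2] is represented by
-- the j : Fin (2t+2) with toℕ j = x - 1.

_mod_ : ℕ → ℕ → ℕ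
a mod zero    = a
a mod (suc m) = a % suc m

-- x ∈ C_i (i is 1-based) iff x - 1 ≡ (2i - 2 + k) mod 2t for some k < r - 2,
-- i.e. x ∈ {2i-1, ..., 2i+r-4} reduced mod 2t into {1,...,2t}
inC : (r t i j : ℕ) → Bool
inC r t i j = any (λ k → j ≡ᵇ ((2 * (i ∸ 1) + k) mod (2 * t))) (upTo (r ∸ 2))

Cᵢ : (r t i : ℕ) → Subset (2 * t + 2)
Cᵢ r t i = tabulate (λ j → inC r t i (toℕ j))

Xset : (t : ℕ) → Subset (2 * t + 2)
Xset t = tabulate (λ j → (toℕ j ≡ᵇ 2 * t) ∨ (toℕ j ≡ᵇ 2 * t + 1))

𝒞′ : (r t : ℕ) → Subset (2 * t + 2) → Set
𝒞′ r t S = Σ ℕ λ i → 1 ≤ i × i ≤ t × S ≡ (Cᵢ r t i ∪ Xset t)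

𝒞″ : (r t : ℕ) → Subset (2 * t + 2) → Set
𝒞″ r t S = Σ ℕ λ i → 1 ≤ i × i ≤ t ∸ 1 × S ≡ (Cᵢ r t i ∪ Cᵢ r t (suc i))

𝒞rt : (r t : ℕ) → Subset (2 * t + 2) → Set
𝒞rt r t S = 𝒞′ r t S ⊎ 𝒞″ r t S
          ⊎ (∣ S ∣ ≡ r + 1 × (∀ T → 𝒞′ r t T ⊎ 𝒞″ r t T → ¬ T ⊆ S))

module Submission where

open import Defs
open import Data.Nat using (ℕ; zero; suc; _+_; _*_; _∸_; _⊔_; _%_; NonZero; >-nonZero)
open import Data.Nat using (_≤_; _<_; z≤n; s≤s; s≤s⁻¹; z<s; _≤?_; _<?_)
open import Data.Nat.Properties
open import Data.Nat.DivMod using (m%n<n; m<n⇒m%n≡m; [m+n]%n≡m%n; [m+kn]%n≡m%n; %-distribˡ-+)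
open import Data.Bool using (Bool; true; false; T)
open import Data.Bool.Properties using (T-≡; T-∨) renaming (_≟_ to _≟ᵇ_)
open import Data.Fin using (Fin; toℕ; fromℕ<) renaming (zero to fzero; suc to fsuc)
import Data.Fin.Properties as Fin
open import Data.Fin.Subset
open import Data.Fin.Subset.Properties
open import Data.List using (upTo)
open import Data.List.Relation.Unary.Any.Properties using (any⁺; any⁻; applyUpTo⁺; applyUpTo⁻)
open import Data.Vec using (_∷_; []; here; there; tabulate)
open import Data.Vec.Properties using (≡-dec; lookup∘tabulate; []=⇒lookup; lookup⇒[]=)
open import Data.Product using (∃; ∃₂; _×_; _,_)
open import Data.Sum using (_⊎_; inj₁; inj₂; [_,_]′; assocˡ; assocʳ) renaming (map to ⊎-map)
open import Data.Empty using (⊥-elim)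
open import Function using (_∘_; id; _⇔_; mk⇔; Equivalence)
open import Function.Properties.Equivalence using () renaming (sym to ⇔-sym)
open import Relation.Nullary using (¬_; Dec; yes; no; contradiction)
open import Relation.Nullary.Decidable using (_×-dec_; _⊎-dec_; _→-dec_) renaming (map to mapDec)
open import Relation.Unary using (Decidable)
open import Relation.Binary.PropositionalEquality

-- Any family 𝒫 of r-sets in which distinct members share at most r - 2 elements gives a sparse
-- paving matroid of rank r whose circuits are the members of 𝒫 together with the (r + 1)-sets
-- containing none of them. Indeed every (r + 1)-set then contains a circuit, which yields circuit
-- elimination because (A ∪ B) - e still has r + 1 elements, and every r-set is either a basis or,
-- when it belongs to 𝒫, a circuit-hyperplane.
-- For 𝒞(r,t), each Cᵢ is the arc of r - 2 consecutive points of the cycle ℤ/2t starting at the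
-- even point 2i - 2, so Cᵢ ∪ Cᵢ₊₁ is the arc of length r starting there. As all lengths are at most
-- 2t - 2, two such arcs with different starting points, or of lengths r and r - 2, leave two points
-- of the first outside the second; X separates each Cᵢ ∪ X from each Cᵢ ∪ Cᵢ₊₁.

module _ where

  private
    variable
      n : ℕ
      p q : Subset n
      x y : Fin n

  _≟ˢ_ : (p q : Subset n) → Dec (p ≡ q)
  _≟ˢ_ = ≡-dec _≟ᵇ_

  x∈p─q⇒x∉q : ∀ (p q : Subset n) → x ∈ p ─ q → x ∉ q
  x∈p─q⇒x∉q {x = fzero}  (_ ∷ p) (true ∷ q)  ()
  x∈p─q⇒x∉q {x = fzero}  (_ ∷ p) (false ∷ q) _         ()
  x∈p─q⇒x∉q {x = fsuc x} (_ ∷ p) (_ ∷ q)     (there h) (there h′) = x∈p─q⇒x∉q p q h h′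

  x∈p-y⇒x≢y : x ∈ p - y → x ≢ y
  x∈p-y⇒x≢y {p = p} {y = y} x∈p-y refl = x∈p─q⇒x∉q p ⁅ y ⁆ x∈p-y (x∈⁅x⁆ y)

  ∣p∪⁅x⁆∣≡1+∣p∣ : ∀ (p : Subset n) → x ∉ p → ∣ p ∪ ⁅ x ⁆ ∣ ≡ suc ∣ p ∣
  ∣p∪⁅x⁆∣≡1+∣p∣ {x = fzero}  (true ∷ p)  x∉p = contradiction here x∉p
  ∣p∪⁅x⁆∣≡1+∣p∣ {x = fzero}  (false ∷ p) x∉p = cong (suc ∘ ∣_∣) (∪-identityʳ p)
  ∣p∪⁅x⁆∣≡1+∣p∣ {x = fsuc x} (true ∷ p)  x∉p = cong suc (∣p∪⁅x⁆∣≡1+∣p∣ p (x∉p ∘ there))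
  ∣p∪⁅x⁆∣≡1+∣p∣ {x = fsuc x} (false ∷ p) x∉p = ∣p∪⁅x⁆∣≡1+∣p∣ p (x∉p ∘ there)

  ∣p∣≡1+∣p-x∣ : ∀ (p : Subset n) → x ∈ p → ∣ p ∣ ≡ suc ∣ p - x ∣
  ∣p∣≡1+∣p-x∣ {x = fzero}  (true ∷ p)  here      = cong (suc ∘ ∣_∣) (sym (p─⊥≡p p))
  ∣p∣≡1+∣p-x∣ {x = fsuc x} (true ∷ p)  (there h) = cong suc (∣p∣≡1+∣p-x∣ p h)
  ∣p∣≡1+∣p-x∣ {x = fsuc x} (false ∷ p) (there h) = ∣p∣≡1+∣p-x∣ p h

  ∣p-x∪⁅y⁆∣≡∣p∣ : ∀ (p : Subset n) → x ∈ p → y ∉ p → ∣ (p - x) ∪ ⁅ y ⁆ ∣ ≡ ∣ p ∣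
  ∣p-x∪⁅y⁆∣≡∣p∣ p x∈p y∉p = begin
    ∣ (p - _) ∪ ⁅ _ ⁆ ∣  ≡⟨ ∣p∪⁅x⁆∣≡1+∣p∣ (p - _) (y∉p ∘ p─q⊆p p _) ⟩
    suc ∣ p - _ ∣        ≡⟨ ∣p∣≡1+∣p-x∣ p x∈p ⟨
    ∣ p ∣                ∎
    where open ≡-Reasoning

  x∈p-y∪⁅z⁆⇒x∈p⊎x≡z : ∀ (p : Subset n) {z} → x ∈ (p - y) ∪ ⁅ z ⁆ → x ∈ p ⊎ x ≡ z
  x∈p-y∪⁅z⁆⇒x∈p⊎x≡z p {z} h with x∈p∪q⁻ (p - _) ⁅ z ⁆ h
  ... | inj₁ x∈p-y = inj₁ (p─q⊆p p _ x∈p-y)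
  ... | inj₂ x∈⁅z⁆ = inj₂ (x∈⁅y⁆⇒x≡y z x∈⁅z⁆)

  p⊆r∧q⊆r⇒p∪q⊆r : ∀ {r : Subset n} → p ⊆ r → q ⊆ r → p ∪ q ⊆ r
  p⊆r∧q⊆r⇒p∪q⊆r {p = p} {q = q} p⊆r q⊆r x∈p∪q with x∈p∪q⁻ p q x∈p∪q
  ... | inj₁ x∈p = p⊆r x∈p
  ... | inj₂ x∈q = q⊆r x∈q

  x∈p⇒⁅x⁆⊆p : x ∈ p → ⁅ x ⁆ ⊆ p
  x∈p⇒⁅x⁆⊆p {x = x} x∈p y∈⁅x⁆ = subst (_∈ _) (sym (x∈⁅y⁆⇒x≡y x y∈⁅x⁆)) x∈p

  p⊆r∧x∈r⇒p∪⁅x⁆⊆r : ∀ {r : Subset n} → p ⊆ r → x ∈ r → p ∪ ⁅ x ⁆ ⊆ r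
  p⊆r∧x∈r⇒p∪⁅x⁆⊆r p⊆r x∈r = p⊆r∧q⊆r⇒p∪q⊆r p⊆r (x∈p⇒⁅x⁆⊆p x∈r)

  p⊆q⇒p-x⊆q-x : p ⊆ q → p - x ⊆ q - x
  p⊆q⇒p-x⊆q-x {p = p} p⊆q h = x∈p∧x≢y⇒x∈p-y (p⊆q (p─q⊆p p _ h)) (x∈p-y⇒x≢y h)

  p⊈q⇒∃∈∉ : ∀ (p q : Subset n) → ¬ p ⊆ q → ∃ λ x → x ∈ p × x ∉ q
  p⊈q⇒∃∈∉ {n} p q p⊈q
    with Fin.¬∀⟶∃¬ n (λ x → x ∈ p → x ∈ q) (λ x → x ∈? p →-dec x ∈? q) (λ h → p⊈q (h _))
  ... | x , ¬[x∈p⇒x∈q] with x ∈? p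
  ...   | yes x∈p = x , x∈p , λ x∈q → ¬[x∈p⇒x∈q] (λ _ → x∈q)
  ...   | no  x∉p = ⊥-elim (¬[x∈p⇒x∈q] (λ x∈p → contradiction x∈p x∉p))

  p⊆q∧∣q∣≤∣p∣⇒p≡q : p ⊆ q → ∣ q ∣ ≤ ∣ p ∣ → p ≡ q
  p⊆q∧∣q∣≤∣p∣⇒p≡q {p = p} {q = q} p⊆q ∣q∣≤∣p∣ with q ⊆? p
  ... | yes q⊆p = ⊆-antisym p⊆q q⊆p
  ... | no  q⊈p = let x , x∈q , x∉p = p⊈q⇒∃∈∉ q p q⊈p in
    contradiction ∣q∣≤∣p∣ (<⇒≱ (p⊂q⇒∣p∣<∣q∣ (p⊆q , x , x∈q , x∉p)))

  ∃-⊆-of-size : ∀ (p : Subset n) {k} → k ≤ ∣ p ∣ → ∃ λ q → q ⊆ p × ∣ q ∣ ≡ k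
  ∃-⊆-of-size {n} _       {zero}  _           = ⊥ , ⊥⊆ , ∣⊥∣≡0 n
  ∃-⊆-of-size (true ∷ p)  {suc k} (s≤s k≤∣p∣) =
    let q , q⊆p , ∣q∣≡k = ∃-⊆-of-size p k≤∣p∣ in true ∷ q , in⊆in q⊆p , cong suc ∣q∣≡k
  ∃-⊆-of-size (false ∷ p) {suc k} 1+k≤∣p∣ =
    let q , q⊆p , ∣q∣≡k = ∃-⊆-of-size p 1+k≤∣p∣ in false ∷ q , out⊆ q⊆p , ∣q∣≡k

  0<∣p∣⇒Nonempty : ∀ (p : Subset n) → 0 < ∣ p ∣ → Nonempty p
  0<∣p∣⇒Nonempty {n} p 0<∣p∣ with nonempty? p
  ... | yes ne = ne
  ... | no ¬ne = contradiction (subst (0 <_) (cong ∣_∣ (Empty-unique ¬ne)) 0<∣p∣)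
                               (<-irrefl (sym (∣⊥∣≡0 n)))

  ∣p∣<n⇒∃∉ : ∀ (p : Subset n) → ∣ p ∣ < n → ∃ λ x → x ∉ p
  ∣p∣<n⇒∃∉ {n} p ∣p∣<n = Fin.¬∀⟶∃¬ n (_∈ p) (_∈? p) p-full
    where
    p-full : ¬ (∀ x → x ∈ p)
    p-full x∈p = <⇒≱ ∣p∣<n (subst (_≤ ∣ p ∣) (∣⊤∣≡n n) (p⊆q⇒∣p∣≤∣q∣ {p = ⊤} (λ {x} _ → x∈p x)))

  ∈-tabulate⁻ : ∀ (f : Fin n → Bool) → x ∈ tabulate f → T (f x)
  ∈-tabulate⁻ {x = x} f x∈f =
    Equivalence.from T-≡ (trans (sym (lookup∘tabulate f x)) ([]=⇒lookup x∈f))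

  ∈-tabulate⁺ : ∀ (f : Fin n → Bool) → T (f x) → x ∈ tabulate f
  ∈-tabulate⁺ {x = x} f fx =
    lookup⇒[]= x (tabulate f) (trans (lookup∘tabulate f x) (Equivalence.to T-≡ fx))

-- for r-sets A ≢ B this says ∣ A ∩ B ∣ ≤ r - 2
TwoOutside : ∀ {n} → Subset n → Subset n → Set
TwoOutside A B = ∃₂ λ x y → x ≢ y × x ∈ A × y ∈ A × x ∉ B × y ∉ B

TwoOutside-weaken : ∀ {n} {A A′ B B′ : Subset n} → A ⊆ A′ → (∀ {x} → x ∈ A → x ∈ B′ → x ∈ B) →
                    TwoOutside A B → TwoOutside A′ B′
TwoOutside-weaken A⊆A′ B′∩A⊆B (x , y , x≢y , x∈A , y∈A , x∉B , y∉B) =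
  x , y , x≢y , A⊆A′ x∈A , A⊆A′ y∈A , x∉B ∘ B′∩A⊆B x∈A , y∉B ∘ B′∩A⊆B y∈A

Free : ∀ {n} → (Subset n → Set) → ℕ → Subset n → Set
Free 𝒫 r S = ∣ S ∣ ≡ r + 1 × (∀ T → 𝒫 T → ¬ T ⊆ S)

HasRankOf-unique : ∀ {n} (𝒞 : Subset n → Set) {X k k′} →
                   HasRankOf 𝒞 X k → HasRankOf 𝒞 X k′ → k ≡ k′
HasRankOf-unique 𝒞 ((I , I⊆X , I-ind , refl) , ≤k) ((J , J⊆X , J-ind , refl) , ≤k′) =
  ≤-antisym (≤k′ I I⊆X I-ind) (≤k J J⊆X J-ind)

module SparsePavingConstruction
  {n r : ℕ} (𝒫 : Subset n → Set) (𝒫? : Decidable 𝒫)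
  (𝒫-size : ∀ {S} → 𝒫 S → ∣ S ∣ ≡ r)
  (𝒫-apart : ∀ {A B} → 𝒫 A → 𝒫 B → A ≢ B → TwoOutside A B)
  (0<r : 0 < r) (r<n : r < n)
  (𝒞 : Subset n → Set) (𝒞⇔ : ∀ S → 𝒞 S ⇔ (𝒫 S ⊎ Free 𝒫 r S))
  where

  private
    variable
      A B I S K L : Subset n
      e x y : Fin n

  𝒞-cases : 𝒞 S → 𝒫 S ⊎ Free 𝒫 r S
  𝒞-cases = Equivalence.to (𝒞⇔ _)

  𝒫⇒𝒞 : 𝒫 S → 𝒞 S
  𝒫⇒𝒞 = Equivalence.from (𝒞⇔ _) ∘ inj₁

  Dependent : Subset n → Set
  Dependent K = ∃ λ D → 𝒞 D × D ⊆ K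

  dependent-mono : K ⊆ L → Dependent K → Dependent L
  dependent-mono K⊆L (D , D-circ , D⊆K) = D , D-circ , λ x∈D → K⊆L (D⊆K x∈D)

  size-r+1⇒dependent : ∣ K ∣ ≡ r + 1 → Dependent K
  size-r+1⇒dependent {K} ∣K∣≡r+1 with anySubset? (λ T → 𝒫? T ×-dec (T ⊆? K))
  ... | yes (T , T∈𝒫 , T⊆K) = T , 𝒫⇒𝒞 T∈𝒫 , T⊆K
  ... | no  ∄T = K , Equivalence.from (𝒞⇔ K) (inj₂ (∣K∣≡r+1 , λ T T∈𝒫 T⊆K → ∄T (T , T∈𝒫 , T⊆K))) , id

  large⇒dependent : r + 1 ≤ ∣ K ∣ → Dependent K
  large⇒dependent {K} r+1≤∣K∣ =
    let J , J⊆K , ∣J∣≡r+1 = ∃-⊆-of-size K r+1≤∣K∣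
    in dependent-mono J⊆K (size-r+1⇒dependent ∣J∣≡r+1)

  independent⇒∣∣≤r : Independent 𝒞 I → ∣ I ∣ ≤ r
  independent⇒∣∣≤r {I} I-ind with ∣ I ∣ ≤? r
  ... | yes ∣I∣≤r = ∣I∣≤r
  ... | no  ∣I∣≰r = let D , D-circ , D⊆I = large⇒dependent (subst (_≤ ∣ I ∣) (+-comm 1 r) (≰⇒> ∣I∣≰r))
                    in ⊥-elim (I-ind D D-circ D⊆I)

  circuit-⊆⇒≡ : 𝒞 A → 𝒞 B → A ⊆ B → A ≡ B
  circuit-⊆⇒≡ a b A⊆B with 𝒞-cases a | 𝒞-cases b
  ... | inj₁ A∈𝒫       | inj₁ B∈𝒫          =
    p⊆q∧∣q∣≤∣p∣⇒p≡q A⊆B (≤-reflexive (trans (𝒫-size B∈𝒫) (sym (𝒫-size A∈𝒫))))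
  ... | inj₂ (∣A∣ , _) | inj₂ (∣B∣ , _)    = p⊆q∧∣q∣≤∣p∣⇒p≡q A⊆B (≤-reflexive (trans ∣B∣ (sym ∣A∣)))
  ... | inj₁ A∈𝒫       | inj₂ (_ , B-free) = ⊥-elim (B-free _ A∈𝒫 A⊆B)
  ... | inj₂ (∣A∣ , _) | inj₁ B∈𝒫          =
    contradiction (subst₂ _≤_ ∣A∣ (𝒫-size B∈𝒫) (p⊆q⇒∣p∣≤∣q∣ A⊆B)) (m+1+n≰m r)

  private
    ∈[A∪B]-e : x ∈ B → x ∉ A → e ∈ A → x ∈ (A ∪ B) - e
    ∈[A∪B]-e x∈B x∉A e∈A = x∈p∧x≢y⇒x∈p-y (x∈p∪q⁺ (inj₂ x∈B)) (λ { refl → x∉A e∈A })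

  elimination-by-one : e ∈ A → x ∈ B → x ∉ A → ∣ A ∣ ≡ r + 1 → Dependent ((A ∪ B) - e)
  elimination-by-one {A = A} {B = B} e∈A x∈B x∉A ∣A∣≡r+1 =
    dependent-mono (p⊆r∧x∈r⇒p∪⁅x⁆⊆r (p⊆q⇒p-x⊆q-x (p⊆p∪q B)) (∈[A∪B]-e x∈B x∉A e∈A))
                   (size-r+1⇒dependent (trans (∣p-x∪⁅y⁆∣≡∣p∣ A e∈A x∉A) ∣A∣≡r+1))

  elimination-by-two : e ∈ A → TwoOutside B A → ∣ A ∣ ≡ r → Dependent ((A ∪ B) - e)
  elimination-by-two {e = e} {A = A} {B = B} e∈A (x , y , x≢y , x∈B , y∈B , x∉A , y∉A) ∣A∣≡r =
    dependent-mono (p⊆r∧x∈r⇒p∪⁅x⁆⊆r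
                     (p⊆r∧x∈r⇒p∪⁅x⁆⊆r (p⊆q⇒p-x⊆q-x (p⊆p∪q B)) (∈[A∪B]-e x∈B x∉A e∈A))
                     (∈[A∪B]-e y∈B y∉A e∈A))
                   (size-r+1⇒dependent ∣K∣≡r+1)
    where
    y∉ : y ∉ (A - e) ∪ ⁅ x ⁆
    y∉ h with x∈p-y∪⁅z⁆⇒x∈p⊎x≡z A h
    ... | inj₁ y∈A = y∉A y∈A
    ... | inj₂ y≡x = x≢y (sym y≡x)
    ∣K∣≡r+1 : ∣ ((A - e) ∪ ⁅ x ⁆) ∪ ⁅ y ⁆ ∣ ≡ r + 1
    ∣K∣≡r+1 = begin
      ∣ ((A - e) ∪ ⁅ x ⁆) ∪ ⁅ y ⁆ ∣  ≡⟨ ∣p∪⁅x⁆∣≡1+∣p∣ _ y∉ ⟩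
      suc ∣ (A - e) ∪ ⁅ x ⁆ ∣        ≡⟨ cong suc (trans (∣p-x∪⁅y⁆∣≡∣p∣ A e∈A x∉A) ∣A∣≡r) ⟩
      suc r                          ≡⟨ +-comm 1 r ⟩
      r + 1                          ∎
      where open ≡-Reasoning

  circuit-elimination : 𝒞 A → 𝒞 B → A ≢ B → e ∈ A → e ∈ B → Dependent ((A ∪ B) - e)
  circuit-elimination {A = A} {B = B} {e = e} a b A≢B e∈A e∈B with 𝒞-cases a | 𝒞-cases b
  ... | inj₂ (∣A∣ , _) | _ =
    let x , x∈B , x∉A = p⊈q⇒∃∈∉ B A (λ B⊆A → A≢B (sym (circuit-⊆⇒≡ b a B⊆A)))
    in elimination-by-one e∈A x∈B x∉A ∣A∣
  ... | inj₁ _ | inj₂ (∣B∣ , _) =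
    let x , x∈A , x∉B = p⊈q⇒∃∈∉ A B (λ A⊆B → A≢B (circuit-⊆⇒≡ a b A⊆B))
    in subst (λ U → Dependent (U - e)) (∪-comm B A) (elimination-by-one e∈B x∈A x∉B ∣B∣)
  ... | inj₁ A∈𝒫 | inj₁ B∈𝒫 =
    elimination-by-two e∈A (𝒫-apart B∈𝒫 A∈𝒫 (A≢B ∘ sym)) (𝒫-size A∈𝒫)

  ⊥∉𝒞 : ¬ 𝒞 ⊥
  ⊥∉𝒞 c with 𝒞-cases c
  ... | inj₁ ⊥∈𝒫       = <⇒≢ 0<r (trans (sym (∣⊥∣≡0 n)) (𝒫-size ⊥∈𝒫))
  ... | inj₂ (∣⊥∣ , _) = 0≢1+n (trans (sym (∣⊥∣≡0 n)) (trans ∣⊥∣ (+-comm r 1)))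

  isCircuitSet : IsCircuitSet 𝒞
  isCircuitSet = record
    { C1 = ⊥∉𝒞
    ; C2 = λ _ _ → circuit-⊆⇒≡
    ; C3 = λ _ _ a b A≢B _ → circuit-elimination a b A≢B
    }

  size-r∧∉𝒫⇒independent : ∣ S ∣ ≡ r → ¬ 𝒫 S → Independent 𝒞 S
  size-r∧∉𝒫⇒independent {S} ∣S∣≡r S∉𝒫 C c C⊆S with 𝒞-cases c
  ... | inj₁ C∈𝒫 =
    S∉𝒫 (subst 𝒫 (p⊆q∧∣q∣≤∣p∣⇒p≡q C⊆S (≤-reflexive (trans ∣S∣≡r (sym (𝒫-size C∈𝒫))))) C∈𝒫)
  ... | inj₂ (∣C∣≡r+1 , _) = m+1+n≰m r (subst₂ _≤_ ∣C∣≡r+1 ∣S∣≡r (p⊆q⇒∣p∣≤∣q∣ C⊆S))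

  𝒫-member-nonempty : 𝒫 S → Nonempty S
  𝒫-member-nonempty {S} S∈𝒫 = 0<∣p∣⇒Nonempty S (subst (0 <_) (sym (𝒫-size S∈𝒫)) 0<r)

  exchange-∉𝒫 : 𝒫 S → y ∉ S → ¬ 𝒫 ((S - x) ∪ ⁅ y ⁆)
  exchange-∉𝒫 {S = S} {y = y} {x = x} S∈𝒫 y∉S S′∈𝒫 =
    let u , v , u≢v , u∈S′ , v∈S′ , u∉S , v∉S = 𝒫-apart S′∈𝒫 S∈𝒫 S′≢S
    in u≢v (trans (new u∈S′ u∉S) (sym (new v∈S′ v∉S)))
    where
    S′≢S : (S - x) ∪ ⁅ y ⁆ ≢ S
    S′≢S S′≡S = y∉S (subst (y ∈_) S′≡S (x∈p∪q⁺ (inj₂ (x∈⁅x⁆ y))))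
    new : ∀ {u} → u ∈ (S - x) ∪ ⁅ y ⁆ → u ∉ S → u ≡ y
    new u∈S′ u∉S with x∈p-y∪⁅z⁆⇒x∈p⊎x≡z S u∈S′
    ... | inj₁ u∈S = contradiction u∈S u∉S
    ... | inj₂ u≡y = u≡y

  exchange-independent : 𝒫 S → x ∈ S → y ∉ S → Independent 𝒞 ((S - x) ∪ ⁅ y ⁆)
  exchange-independent {S} S∈𝒫 x∈S y∉S =
    size-r∧∉𝒫⇒independent (trans (∣p-x∪⁅y⁆∣≡∣p∣ S x∈S y∉S) (𝒫-size S∈𝒫)) (exchange-∉𝒫 S∈𝒫 y∉S)

  ∃-independent-of-size-r : ∃ λ I → Independent 𝒞 I × ∣ I ∣ ≡ r
  ∃-independent-of-size-r with ∃-⊆-of-size ⊤ (subst (r ≤_) (sym (∣⊤∣≡n n)) (<⇒≤ r<n))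
  ... | S , _ , ∣S∣≡r with 𝒫? S
  ... | no S∉𝒫  = S , size-r∧∉𝒫⇒independent ∣S∣≡r S∉𝒫 , ∣S∣≡r
  ... | yes S∈𝒫 =
    let x , x∈S = 𝒫-member-nonempty S∈𝒫
        y , y∉S = ∣p∣<n⇒∃∉ S (subst (_< n) (sym ∣S∣≡r) r<n)
    in (S - x) ∪ ⁅ y ⁆ , exchange-independent S∈𝒫 x∈S y∉S , trans (∣p-x∪⁅y⁆∣≡∣p∣ S x∈S y∉S) ∣S∣≡r

  matroidRank : MatroidRank 𝒞 r
  matroidRank = ∃-independent-of-size-r , λ _ → independent⇒∣∣≤r

  𝒫-member-minus-independent : 𝒫 S → x ∈ S → Independent 𝒞 (S - x)
  𝒫-member-minus-independent {S} S∈𝒫 x∈S C c C⊆S-x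
    with circuit-⊆⇒≡ c (𝒫⇒𝒞 S∈𝒫) (λ u∈C → p─q⊆p S _ (C⊆S-x u∈C))
  ... | refl = x∈p-y⇒x≢y (C⊆S-x x∈S) refl

  independent-⊆-𝒫-member⇒< : 𝒫 S → I ⊆ S → Independent 𝒞 I → ∣ I ∣ < r
  independent-⊆-𝒫-member⇒< {S} {I} S∈𝒫 I⊆S I-ind with r ≤? ∣ I ∣
  ... | no  r≰∣I∣ = ≰⇒> r≰∣I∣
  ... | yes r≤∣I∣ with p⊆q∧∣q∣≤∣p∣⇒p≡q I⊆S (subst (_≤ ∣ I ∣) (sym (𝒫-size S∈𝒫)) r≤∣I∣)
  ...   | refl = ⊥-elim (I-ind I (𝒫⇒𝒞 S∈𝒫) id)

  𝒫⇒rank : 𝒫 S → HasRankOf 𝒞 S (r ∸ 1)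
  𝒫⇒rank {S} S∈𝒫 with 𝒫-member-nonempty S∈𝒫
  ... | x , x∈S =
    (S - x , p─q⊆p S _ , 𝒫-member-minus-independent S∈𝒫 x∈S , ∣S-x∣≡r∸1) ,
    λ I I⊆S I-ind → ∸-monoˡ-≤ 1 (independent-⊆-𝒫-member⇒< S∈𝒫 I⊆S I-ind)
    where
    ∣S-x∣≡r∸1 : ∣ S - x ∣ ≡ r ∸ 1
    ∣S-x∣≡r∸1 = cong (_∸ 1) (trans (sym (∣p∣≡1+∣p-x∣ S x∈S)) (𝒫-size S∈𝒫))

  𝒫⇒flat : 𝒫 S → IsFlat 𝒞 S
  𝒫⇒flat {S} S∈𝒫 e e∉S k rank-k with 𝒫-member-nonempty S∈𝒫
  ... | x , x∈S = subst (HasRankOf 𝒞 (S ∪ ⁅ e ⁆)) r≡1+k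
    ((S′ , S′⊆S∪⁅e⁆ , exchange-independent S∈𝒫 x∈S e∉S , trans (∣p-x∪⁅y⁆∣≡∣p∣ S x∈S e∉S) (𝒫-size S∈𝒫)) ,
     λ _ _ → independent⇒∣∣≤r)
    where
    S′ = (S - x) ∪ ⁅ e ⁆
    S′⊆S∪⁅e⁆ : S′ ⊆ S ∪ ⁅ e ⁆
    S′⊆S∪⁅e⁆ = p⊆r∧x∈r⇒p∪⁅x⁆⊆r (λ u∈S-x → x∈p∪q⁺ (inj₁ (p─q⊆p S _ u∈S-x))) (x∈p∪q⁺ (inj₂ (x∈⁅x⁆ e)))
    r≡1+k : r ≡ suc k
    r≡1+k = trans (sym (m+[n∸m]≡n 0<r)) (cong suc (HasRankOf-unique 𝒞 (𝒫⇒rank S∈𝒫) rank-k))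

  size-r∧∉𝒫⇒basis : ∣ S ∣ ≡ r → ¬ 𝒫 S → IsBasis 𝒞 S
  size-r∧∉𝒫⇒basis {S} ∣S∣≡r S∉𝒫 = size-r∧∉𝒫⇒independent ∣S∣≡r S∉𝒫 , λ e e∉S S∪⁅e⁆-ind →
    let D , D-circ , D⊆S∪⁅e⁆ =
          size-r+1⇒dependent (trans (∣p∪⁅x⁆∣≡1+∣p∣ S e∉S) (trans (cong suc ∣S∣≡r) (+-comm 1 r)))
    in S∪⁅e⁆-ind D D-circ D⊆S∪⁅e⁆

  sparsePaving : SparsePaving 𝒞 r
  sparsePaving S ∣S∣≡r with 𝒫? S
  ... | no  S∉𝒫 = inj₁ (size-r∧∉𝒫⇒basis ∣S∣≡r S∉𝒫)
  ... | yes S∈𝒫 = inj₂ (𝒫⇒𝒞 S∈𝒫 , 𝒫⇒flat S∈𝒫 , 𝒫⇒rank S∈𝒫)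

  isRankSparsePavingCircuitSet : IsRankSparsePavingCircuitSet 𝒞 r
  isRankSparsePavingCircuitSet = isCircuitSet , matroidRank , sparsePaving

m%d≡n%d⇒[m+o]%d≡[n+o]%d : ∀ {m n} o d .{{_ : NonZero d}} → m % d ≡ n % d → (m + o) % d ≡ (n + o) % d
m%d≡n%d⇒[m+o]%d≡[n+o]%d {m} {n} o d eq = begin
  (m + o) % d              ≡⟨ %-distribˡ-+ m o d ⟩
  (m % d + o % d) % d      ≡⟨ cong (λ u → (u + o % d) % d) eq ⟩
  (n % d + o % d) % d      ≡⟨ %-distribˡ-+ n o d ⟨
  (n + o) % d              ∎
  where open ≡-Reasoning

[m+n]%d≡[m+o]%d⇒n%d≡o%d : ∀ m {n o} d .{{_ : NonZero d}} → (m + n) % d ≡ (m + o) % d → n % d ≡ o % d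
[m+n]%d≡[m+o]%d⇒n%d≡o%d m {n} {o} d@(suc d′) eq = begin
  n % d                 ≡⟨ [m+kn]%n≡m%n n m d ⟨
  (n + m * d) % d       ≡⟨ cong (_% d) (complete n) ⟩
  (m + n + m * d′) % d  ≡⟨ m%d≡n%d⇒[m+o]%d≡[n+o]%d {m + n} {m + o} (m * d′) d eq ⟩
  (m + o + m * d′) % d  ≡⟨ cong (_% d) (complete o) ⟨
  (o + m * d) % d       ≡⟨ [m+kn]%n≡m%n o m d ⟩
  o % d                 ∎
  where
  open ≡-Reasoning
  complete : ∀ u → u + m * d ≡ m + u + m * d′
  complete u = begin
    u + m * suc d′    ≡⟨ cong (u +_) (*-suc m d′) ⟩
    u + (m + m * d′)  ≡⟨ +-assoc u m _ ⟨
    u + m + m * d′    ≡⟨ cong (_+ m * d′) (+-comm u m) ⟩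
    m + u + m * d′    ∎

module CyclicArcs (N : ℕ) .{{_ : NonZero N}} {n : ℕ} (N≤n : N ≤ n) where

  private
    variable
      s s′ k m m′ v w δ d : ℕ
      x : Fin n

  pt : ℕ → Fin n
  pt v = fromℕ< (<-≤-trans (m%n<n v N) N≤n)

  toℕ-pt : ∀ v → toℕ (pt v) ≡ v % N
  toℕ-pt v = Fin.toℕ-fromℕ< _

  pt-cong : v % N ≡ w % N → pt v ≡ pt w
  pt-cong {v} {w} eq = Fin.toℕ-injective (trans (toℕ-pt v) (trans eq (sym (toℕ-pt w))))

  pt-offset-injective : v < N → w < N → pt (s + v) ≡ pt (s + w) → v ≡ w
  pt-offset-injective {v} {w} {s} v<N w<N eq = begin
    v      ≡⟨ m<n⇒m%n≡m v<N ⟨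
    v % N  ≡⟨ [m+n]%d≡[m+o]%d⇒n%d≡o%d s N (trans (sym (toℕ-pt _)) (trans (cong toℕ eq) (toℕ-pt _))) ⟩
    w % N  ≡⟨ m<n⇒m%n≡m w<N ⟩
    w      ∎
    where open ≡-Reasoning

  arc : ℕ → ℕ → Subset n
  arc s zero    = ⊥
  arc s (suc m) = arc s m ∪ ⁅ pt (s + m) ⁆

  pt∈arc : k < m → pt (s + k) ∈ arc s m
  pt∈arc {k} {suc m} k<1+m with m≤n⇒m<n∨m≡n (s≤s⁻¹ k<1+m)
  ... | inj₁ k<m = x∈p∪q⁺ (inj₁ (pt∈arc k<m))
  ... | inj₂ refl = x∈p∪q⁺ (inj₂ (x∈⁅x⁆ _))

  ∈-arc⁻ : ∀ s m → x ∈ arc s m → ∃ λ k → k < m × x ≡ pt (s + k)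
  ∈-arc⁻ s zero    x∈⊥ = ⊥-elim (∉⊥ x∈⊥)
  ∈-arc⁻ s (suc m) x∈arc with x∈p∪q⁻ (arc s m) _ x∈arc
  ... | inj₁ x∈arc′ = let k , k<m , x≡ = ∈-arc⁻ s m x∈arc′ in k , m≤n⇒m≤1+n k<m , x≡
  ... | inj₂ x∈⁅pt⁆ = m , ≤-refl , x∈⁅y⁆⇒x≡y _ x∈⁅pt⁆

  arc-below-N : ∀ s m → x ∈ arc s m → toℕ x < N
  arc-below-N s m x∈arc with ∈-arc⁻ s m x∈arc
  ... | k , _ , x≡pt = subst (_< N) (sym (trans (cong toℕ x≡pt) (toℕ-pt _))) (m%n<n _ N)

  pt∉arc : m ≤ v → v < N → pt (s + v) ∉ arc s m
  pt∉arc {m} {v} {s} m≤v v<N pt∈arc with ∈-arc⁻ s m pt∈arc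
  ... | k , k<m , eq =
    let k<v = <-≤-trans k<m m≤v in <⇒≢ k<v (sym (pt-offset-injective v<N (<-trans k<v v<N) eq))

  ∣arc∣ : m ≤ N → ∣ arc s m ∣ ≡ m
  ∣arc∣ {zero}  _   = ∣⊥∣≡0 n
  ∣arc∣ {suc m} {s} m<N =
    trans (∣p∪⁅x⁆∣≡1+∣p∣ (arc s m) (pt∉arc ≤-refl m<N)) (cong suc (∣arc∣ (<⇒≤ m<N)))

  arc-cong : s % N ≡ s′ % N → arc s m ≡ arc s′ m
  arc-cong {m = zero}  _  = refl
  arc-cong {m = suc m} eq =
    cong₂ _∪_ (arc-cong {m = m} eq) (cong ⁅_⁆ (pt-cong (m%d≡n%d⇒[m+o]%d≡[n+o]%d m N eq)))

  pt∈shifted-arc : δ ≤ v → v < δ + m → pt (s + v) ∈ arc (s + δ) m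
  pt∈shifted-arc {δ} {v} {m} {s} δ≤v v<δ+m = subst (_∈ arc (s + δ) m) (cong pt s+δ+k≡s+v) (pt∈arc k<m)
    where
    s+δ+k≡s+v : s + δ + (v ∸ δ) ≡ s + v
    s+δ+k≡s+v = trans (+-assoc s δ (v ∸ δ)) (cong (s +_) (m+[n∸m]≡n δ≤v))
    k<m : v ∸ δ < m
    k<m = +-cancelˡ-< δ _ _ (subst (_< δ + m) (sym (m+[n∸m]≡n δ≤v)) v<δ+m)

  arc-⊆ : ∀ {p} → (∀ {k} → k < m → pt (s + k) ∈ p) → arc s m ⊆ p
  arc-⊆ {m} {s} pts∈p x∈arc with ∈-arc⁻ s m x∈arc
  ... | k , k<m , x≡pt = subst (_∈ _) (sym x≡pt) (pts∈p k<m)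

  arc-∪ : d ≤ m → m ≤ d + m′ → arc s m ∪ arc (s + d) m′ ≡ arc s (d + m′)
  arc-∪ {d} {m} {m′} {s} d≤m m≤d+m′ = ⊆-antisym
    (p⊆r∧q⊆r⇒p∪q⊆r (arc-⊆ λ k<m → pt∈arc (<-≤-trans k<m m≤d+m′))
                   (arc-⊆ λ {k} k<m′ →
                     subst (_∈ _) (cong pt (sym (+-assoc s d k))) (pt∈arc (+-monoʳ-< d k<m′))))
    (arc-⊆ split)
    where
    split : k < d + m′ → pt (s + k) ∈ arc s m ∪ arc (s + d) m′
    split {k} k<d+m′ with k <? m
    ... | yes k<m = x∈p∪q⁺ (inj₁ (pt∈arc k<m))
    ... | no  k≮m = x∈p∪q⁺ (inj₂ (pt∈shifted-arc (≤-trans d≤m (≮⇒≥ k≮m)) k<d+m′))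

  -- The witnesses sit at offsets m′ ⊔ δ and m′ ⊔ δ + 1 from s: past the end of arc s m′ and not
  -- before the start of arc (s + δ) m.
  arc-twoOutside : 2 ≤ m → 2 + m′ ≤ N → 2 + δ ≤ N → 2 + m′ ≤ δ + m →
                   TwoOutside (arc (s + δ) m) (arc s m′)
  arc-twoOutside {m} {m′} {δ} {s} 2≤m 2+m′≤N 2+δ≤N 2+m′≤δ+m =
    pt (s + u) , pt (s + suc u) , (λ eq → 1+n≢n (sym (pt-offset-injective u<N 1+u<N eq))) ,
    pt∈shifted-arc δ≤u u<δ+m , pt∈shifted-arc (m≤n⇒m≤1+n δ≤u) 2+u≤δ+m ,
    pt∉arc m′≤u u<N , pt∉arc (m≤n⇒m≤1+n m′≤u) 1+u<N
    where
    u : ℕ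
    u = m′ ⊔ δ
    m′≤u : m′ ≤ u
    m′≤u = m≤m⊔n m′ δ
    δ≤u : δ ≤ u
    δ≤u = m≤n⊔m m′ δ
    1+u<N : suc u < N
    1+u<N = ⊔-lub 2+m′≤N 2+δ≤N
    u<N : u < N
    u<N = <-trans (n<1+n u) 1+u<N
    2+u≤δ+m : 2 + u ≤ δ + m
    2+u≤δ+m = ⊔-lub 2+m′≤δ+m (subst (_≤ δ + m) (+-comm δ 2) (+-monoʳ-≤ δ 2≤m))
    u<δ+m : u < δ + m
    u<δ+m = <-trans (n<1+n u) 2+u≤δ+m

mod≡% : ∀ a d .{{_ : NonZero d}} → a mod d ≡ a % d
mod≡% a (suc d) = refl

module Construction (r t : ℕ) .{{_ : NonZero t}} (4≤r : 4 ≤ r) (2+r≤2t : 2 + r ≤ 2 * t) where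

  private
    instance
      2t≢0 : NonZero (2 * t)
      2t≢0 = m*n≢0 2 t

  open CyclicArcs (2 * t) (m≤m+n (2 * t) 2)

  private
    variable
      a b m m′ : ℕ
      A B S : Subset (2 * t + 2)
      x : Fin (2 * t + 2)

  r≤2t : r ≤ 2 * t
  r≤2t = ≤-trans (m≤n+m r 2) 2+r≤2t

  2≤r∸2 : 2 ≤ r ∸ 2
  2≤r∸2 = ∸-monoˡ-≤ 2 4≤r

  2≤r : 2 ≤ r
  2≤r = ≤-trans 2≤r∸2 (m∸n≤m r 2)

  2+[r∸2]≡r : 2 + (r ∸ 2) ≡ r
  2+[r∸2]≡r = m+[n∸m]≡n 2≤r

  2+[r∸2]≤2t : 2 + (r ∸ 2) ≤ 2 * t
  2+[r∸2]≤2t = subst (_≤ 2 * t) (sym 2+[r∸2]≡r) r≤2t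

  Cᵢ≡arc : ∀ i → Cᵢ r t i ≡ arc (2 * (i ∸ 1)) (r ∸ 2)
  Cᵢ≡arc i = ⊆-antisym Cᵢ⊆arc (arc-⊆ pt∈Cᵢ)
    where
    s : ℕ
    s = 2 * (i ∸ 1)
    Cᵢ⊆arc : Cᵢ r t i ⊆ arc s (r ∸ 2)
    Cᵢ⊆arc {x} x∈Cᵢ with applyUpTo⁻ id (any⁻ _ (upTo (r ∸ 2)) (∈-tabulate⁻ _ x∈Cᵢ))
    ... | k , k<r∸2 , x≡ᵇ = subst (_∈ arc s (r ∸ 2)) (sym x≡pt) (pt∈arc k<r∸2)
      where
      x≡pt : x ≡ pt (s + k)
      x≡pt = Fin.toℕ-injective
        (trans (≡ᵇ⇒≡ _ _ x≡ᵇ) (trans (mod≡% (s + k) (2 * t)) (sym (toℕ-pt (s + k)))))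
    pt∈Cᵢ : ∀ {k} → k < r ∸ 2 → pt (s + k) ∈ Cᵢ r t i
    pt∈Cᵢ {k} k<r∸2 = ∈-tabulate⁺ _ (any⁺ _ (applyUpTo⁺ id (≡⇒≡ᵇ _ _ toℕ≡) k<r∸2))
      where
      toℕ≡ : toℕ (pt (s + k)) ≡ (s + k) mod (2 * t)
      toℕ≡ = trans (toℕ-pt (s + k)) (sym (mod≡% (s + k) (2 * t)))

  ∈Xset⁻ : x ∈ Xset t → toℕ x ≡ 2 * t ⊎ toℕ x ≡ 2 * t + 1
  ∈Xset⁻ x∈X = ⊎-map (≡ᵇ⇒≡ _ _) (≡ᵇ⇒≡ _ _) (Equivalence.to T-∨ (∈-tabulate⁻ _ x∈X))

  ∈Xset⁺ : toℕ x ≡ 2 * t ⊎ toℕ x ≡ 2 * t + 1 → x ∈ Xset t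
  ∈Xset⁺ toℕx = ∈-tabulate⁺ _ (Equivalence.from T-∨ (⊎-map (≡⇒≡ᵇ _ _) (≡⇒≡ᵇ _ _) toℕx))

  ∈Xset⇒2t≤toℕ : x ∈ Xset t → 2 * t ≤ toℕ x
  ∈Xset⇒2t≤toℕ x∈X with ∈Xset⁻ x∈X
  ... | inj₁ x≡2t   = ≤-reflexive (sym x≡2t)
  ... | inj₂ x≡2t+1 = subst (2 * t ≤_) (sym x≡2t+1) (m≤m+n (2 * t) 1)

  ∈Xset⇒∉arc : ∀ s m → x ∈ Xset t → x ∉ arc s m
  ∈Xset⇒∉arc s m x∈X x∈arc = <⇒≱ (arc-below-N s m x∈arc) (∈Xset⇒2t≤toℕ x∈X)

  ∈arc∧∈arc∪Xset⇒∈arc : ∀ s m s′ m′ → x ∈ arc s m → x ∈ arc s′ m′ ∪ Xset t → x ∈ arc s′ m′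
  ∈arc∧∈arc∪Xset⇒∈arc s m s′ m′ x∈arc x∈arc′∪X with x∈p∪q⁻ _ (Xset t) x∈arc′∪X
  ... | inj₁ x∈arc′ = x∈arc′
  ... | inj₂ x∈X    = contradiction x∈arc (∈Xset⇒∉arc s m x∈X)

  ∞₁ ∞₂ : Fin (2 * t + 2)
  ∞₁ = fromℕ< (m<m+n (2 * t) z<s)
  ∞₂ = fromℕ< (+-monoʳ-< (2 * t) (n<1+n 1))

  ∞₁≢∞₂ : ∞₁ ≢ ∞₂
  ∞₁≢∞₂ ∞₁≡∞₂ = <⇒≢ (m<m+n (2 * t) z<s)
    (trans (sym (Fin.toℕ-fromℕ< _)) (trans (cong toℕ ∞₁≡∞₂) (Fin.toℕ-fromℕ< _)))

  ∞₁∈Xset : ∞₁ ∈ Xset t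
  ∞₁∈Xset = ∈Xset⁺ (inj₁ (Fin.toℕ-fromℕ< _))

  ∞₂∈Xset : ∞₂ ∈ Xset t
  ∞₂∈Xset = ∈Xset⁺ (inj₂ (Fin.toℕ-fromℕ< _))

  Xset≡⁅∞₁⁆∪⁅∞₂⁆ : Xset t ≡ ⁅ ∞₁ ⁆ ∪ ⁅ ∞₂ ⁆
  Xset≡⁅∞₁⁆∪⁅∞₂⁆ = ⊆-antisym X⊆ (p⊆r∧x∈r⇒p∪⁅x⁆⊆r (x∈p⇒⁅x⁆⊆p ∞₁∈Xset) ∞₂∈Xset)
    where
    toℕ≡⇒∈⁅⁆ : ∀ {x y : Fin (2 * t + 2)} → toℕ x ≡ toℕ y → x ∈ ⁅ y ⁆
    toℕ≡⇒∈⁅⁆ toℕx≡toℕy = Equivalence.from x∈⁅y⁆⇔x≡y (Fin.toℕ-injective toℕx≡toℕy)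
    X⊆ : Xset t ⊆ ⁅ ∞₁ ⁆ ∪ ⁅ ∞₂ ⁆
    X⊆ {x} x∈X with ∈Xset⁻ x∈X
    ... | inj₁ x≡2t   = x∈p∪q⁺ (inj₁ (toℕ≡⇒∈⁅⁆ (trans x≡2t (sym (Fin.toℕ-fromℕ< _)))))
    ... | inj₂ x≡2t+1 = x∈p∪q⁺ (inj₂ (toℕ≡⇒∈⁅⁆ (trans x≡2t+1 (sym (Fin.toℕ-fromℕ< _)))))

  even-offset : a < t → b < t →
                ∃ λ c → c < t × (a ≢ b → 0 < c) × (2 * b + 2 * c) % (2 * t) ≡ (2 * a) % (2 * t)
  even-offset {a} {b} a<t b<t with b ≤? a
  ... | yes b≤a =
    a ∸ b , ≤-<-trans (m∸n≤m a b) a<t , (λ a≢b → m<n⇒0<n∸m (≤∧≢⇒< b≤a (a≢b ∘ sym))) ,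
    cong (_% (2 * t)) (trans (sym (*-distribˡ-+ 2 b (a ∸ b))) (cong (2 *_) (m+[n∸m]≡n b≤a)))
  ... | no  b≰a = c , c<t , (λ _ → 0<c) , 2b+2c≡2a+2t
    where
    c = t + a ∸ b
    b≤t+a : b ≤ t + a
    b≤t+a = ≤-trans (<⇒≤ b<t) (m≤m+n t a)
    c<t : c < t
    c<t = +-cancelʳ-< b c t (subst (_< t + b) (sym (m∸n+n≡m b≤t+a)) (+-monoʳ-< t (≰⇒> b≰a)))
    0<c : 0 < c
    0<c = m<n⇒0<n∸m (<-≤-trans b<t (m≤m+n t a))
    b+c≡a+t : b + c ≡ a + t
    b+c≡a+t = trans (m+[n∸m]≡n b≤t+a) (+-comm t a)
    2b+2c≡2a+2t : (2 * b + 2 * c) % (2 * t) ≡ (2 * a) % (2 * t)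
    2b+2c≡2a+2t = begin
      (2 * b + 2 * c) % (2 * t)    ≡⟨ cong (_% (2 * t)) (sym (*-distribˡ-+ 2 b c)) ⟩
      (2 * (b + c)) % (2 * t)      ≡⟨ cong (λ u → (2 * u) % (2 * t)) b+c≡a+t ⟩
      (2 * (a + t)) % (2 * t)      ≡⟨ cong (_% (2 * t)) (*-distribˡ-+ 2 a t) ⟩
      (2 * a + 2 * t) % (2 * t)    ≡⟨ [m+n]%n≡m%n (2 * a) (2 * t) ⟩
      (2 * a) % (2 * t)            ∎
      where open ≡-Reasoning

  even-arcs-twoOutside : a < t → b < t → 2 ≤ m → 2 + m′ ≤ 2 * t → (a ≢ b × m′ ≤ m) ⊎ 2 + m′ ≤ m →
                         TwoOutside (arc (2 * a) m) (arc (2 * b) m′)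
  even-arcs-twoOutside {a} {b} {m} {m′} a<t b<t 2≤m 2+m′≤2t separated with even-offset a<t b<t
  ... | c , c<t , a≢b⇒0<c , 2b+2c≡2a =
    subst (λ A → TwoOutside A (arc (2 * b) m′)) (arc-cong {m = m} 2b+2c≡2a)
          (arc-twoOutside 2≤m 2+m′≤2t 2+2c≤2t 2+m′≤2c+m)
    where
    2+2c≤2t : 2 + 2 * c ≤ 2 * t
    2+2c≤2t = subst (_≤ 2 * t) (*-suc 2 c) (*-monoʳ-≤ 2 c<t)
    2+m′≤2c+m : 2 + m′ ≤ 2 * c + m
    2+m′≤2c+m = [ (λ (a≢b , m′≤m) → +-mono-≤ (*-monoʳ-≤ 2 (a≢b⇒0<c a≢b)) m′≤m)
                , (λ 2+m′≤m → ≤-trans 2+m′≤m (m≤n+m m (2 * c))) ]′ separated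

  -- C′ a and C″ a are the paper's C_{a+1} ∪ X and C_{a+1} ∪ C_{a+2}
  C′ C″ : ℕ → Subset (2 * t + 2)
  C′ a = arc (2 * a) (r ∸ 2) ∪ Xset t
  C″ a = arc (2 * a) r

  ∣C′∣≡r : ∀ a → ∣ C′ a ∣ ≡ r
  ∣C′∣≡r a = begin
    ∣ Arc ∪ Xset t ∣                 ≡⟨ cong (λ X → ∣ Arc ∪ X ∣) Xset≡⁅∞₁⁆∪⁅∞₂⁆ ⟩
    ∣ Arc ∪ (⁅ ∞₁ ⁆ ∪ ⁅ ∞₂ ⁆) ∣     ≡⟨ cong ∣_∣ (∪-assoc Arc ⁅ ∞₁ ⁆ ⁅ ∞₂ ⁆) ⟨
    ∣ (Arc ∪ ⁅ ∞₁ ⁆) ∪ ⁅ ∞₂ ⁆ ∣     ≡⟨ ∣p∪⁅x⁆∣≡1+∣p∣ (Arc ∪ ⁅ ∞₁ ⁆) ∞₂∉Arc∪⁅∞₁⁆ ⟩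
    suc ∣ Arc ∪ ⁅ ∞₁ ⁆ ∣             ≡⟨ cong suc (∣p∪⁅x⁆∣≡1+∣p∣ Arc (∈Xset⇒∉arc (2 * a) (r ∸ 2) ∞₁∈Xset)) ⟩
    2 + ∣ Arc ∣                      ≡⟨ cong (2 +_) (∣arc∣ (≤-trans (m∸n≤m r 2) r≤2t)) ⟩
    2 + (r ∸ 2)                      ≡⟨ 2+[r∸2]≡r ⟩
    r                                ∎
    where
    open ≡-Reasoning
    Arc = arc (2 * a) (r ∸ 2)
    ∞₂∉Arc∪⁅∞₁⁆ : ∞₂ ∉ Arc ∪ ⁅ ∞₁ ⁆
    ∞₂∉Arc∪⁅∞₁⁆ ∞₂∈ with x∈p∪q⁻ Arc ⁅ ∞₁ ⁆ ∞₂∈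
    ... | inj₁ ∞₂∈Arc = ∈Xset⇒∉arc (2 * a) (r ∸ 2) ∞₂∈Xset ∞₂∈Arc
    ... | inj₂ ∞₂∈⁅∞₁⁆ = ∞₁≢∞₂ (sym (x∈⁅y⁆⇒x≡y ∞₁ ∞₂∈⁅∞₁⁆))

  ∣C″∣≡r : ∀ a → ∣ C″ a ∣ ≡ r
  ∣C″∣≡r a = ∣arc∣ r≤2t

  Cᵢ∪X≡C′ : ∀ a → Cᵢ r t (suc a) ∪ Xset t ≡ C′ a
  Cᵢ∪X≡C′ a = cong (_∪ Xset t) (Cᵢ≡arc (suc a))

  Cᵢ∪Cᵢ₊₁≡C″ : ∀ a → Cᵢ r t (suc a) ∪ Cᵢ r t (suc (suc a)) ≡ C″ a
  Cᵢ∪Cᵢ₊₁≡C″ a = begin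
    Cᵢ r t (suc a) ∪ Cᵢ r t (suc (suc a))
      ≡⟨ cong₂ _∪_ (Cᵢ≡arc (suc a)) (Cᵢ≡arc (suc (suc a))) ⟩
    arc (2 * a) (r ∸ 2) ∪ arc (2 * suc a) (r ∸ 2)
      ≡⟨ cong (λ s → arc (2 * a) (r ∸ 2) ∪ arc s (r ∸ 2)) 2[1+a]≡2a+2 ⟩
    arc (2 * a) (r ∸ 2) ∪ arc (2 * a + 2) (r ∸ 2)
      ≡⟨ arc-∪ 2≤r∸2 (m≤n+m (r ∸ 2) 2) ⟩
    arc (2 * a) (2 + (r ∸ 2))
      ≡⟨ cong (arc (2 * a)) 2+[r∸2]≡r ⟩
    C″ a ∎
    where
    open ≡-Reasoning
    2[1+a]≡2a+2 : 2 * suc a ≡ 2 * a + 2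
    2[1+a]≡2a+2 = trans (*-suc 2 a) (+-comm 2 (2 * a))

  𝒞′⇔ : 𝒞′ r t S ⇔ (∃ λ a → a < t × S ≡ C′ a)
  𝒞′⇔ = mk⇔ (λ { (zero , () , _) ; (suc a , _ , a<t , S≡) → a , a<t , trans S≡ (Cᵢ∪X≡C′ a) })
            (λ (a , a<t , S≡) → suc a , s≤s z≤n , a<t , trans S≡ (sym (Cᵢ∪X≡C′ a)))

  𝒞″⇔ : 𝒞″ r t S ⇔ (∃ λ a → a < t ∸ 1 × S ≡ C″ a)
  𝒞″⇔ = mk⇔ (λ { (zero , () , _) ; (suc a , _ , a<t∸1 , S≡) → a , a<t∸1 , trans S≡ (Cᵢ∪Cᵢ₊₁≡C″ a) })
            (λ (a , a<t∸1 , S≡) → suc a , s≤s z≤n , a<t∸1 , trans S≡ (sym (Cᵢ∪Cᵢ₊₁≡C″ a)))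

  C′-apart : a < t → b < t → a ≢ b → TwoOutside (C′ a) (C′ b)
  C′-apart {a} {b} a<t b<t a≢b =
    TwoOutside-weaken (p⊆p∪q (Xset t)) (∈arc∧∈arc∪Xset⇒∈arc (2 * a) (r ∸ 2) (2 * b) (r ∸ 2))
      (even-arcs-twoOutside a<t b<t 2≤r∸2 2+[r∸2]≤2t (inj₁ (a≢b , ≤-refl)))

  C″-apart : a < t → b < t → a ≢ b → TwoOutside (C″ a) (C″ b)
  C″-apart a<t b<t a≢b = even-arcs-twoOutside a<t b<t 2≤r 2+r≤2t (inj₁ (a≢b , ≤-refl))

  C′-C″-apart : ∀ a b → TwoOutside (C′ a) (C″ b)
  C′-C″-apart a b = ∞₁ , ∞₂ , ∞₁≢∞₂ , x∈p∪q⁺ (inj₂ ∞₁∈Xset) , x∈p∪q⁺ (inj₂ ∞₂∈Xset) ,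
                    ∈Xset⇒∉arc (2 * b) r ∞₁∈Xset , ∈Xset⇒∉arc (2 * b) r ∞₂∈Xset

  C″-C′-apart : a < t → b < t → TwoOutside (C″ a) (C′ b)
  C″-C′-apart {a} {b} a<t b<t =
    TwoOutside-weaken id (∈arc∧∈arc∪Xset⇒∈arc (2 * a) r (2 * b) (r ∸ 2))
      (even-arcs-twoOutside a<t b<t 2≤r 2+[r∸2]≤2t (inj₂ (≤-reflexive 2+[r∸2]≡r)))

  <t∸1⇒<t : a < t ∸ 1 → a < t
  <t∸1⇒<t a<t∸1 = <-≤-trans a<t∸1 (m∸n≤m t 1)

  𝒫 : Subset (2 * t + 2) → Set
  𝒫 S = 𝒞′ r t S ⊎ 𝒞″ r t S

  𝒫-size : 𝒫 S → ∣ S ∣ ≡ r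
  𝒫-size (inj₁ S∈𝒞′) = let a , _ , S≡C′a = Equivalence.to 𝒞′⇔ S∈𝒞′ in trans (cong ∣_∣ S≡C′a) (∣C′∣≡r a)
  𝒫-size (inj₂ S∈𝒞″) = let a , _ , S≡C″a = Equivalence.to 𝒞″⇔ S∈𝒞″ in trans (cong ∣_∣ S≡C″a) (∣C″∣≡r a)

  𝒫-apart : 𝒫 A → 𝒫 B → A ≢ B → TwoOutside A B
  𝒫-apart (inj₁ A∈𝒞′) (inj₁ B∈𝒞′) A≢B with Equivalence.to 𝒞′⇔ A∈𝒞′ | Equivalence.to 𝒞′⇔ B∈𝒞′
  ... | a , a<t , refl | b , b<t , refl = C′-apart a<t b<t λ { refl → A≢B refl }
  𝒫-apart (inj₂ A∈𝒞″) (inj₂ B∈𝒞″) A≢B with Equivalence.to 𝒞″⇔ A∈𝒞″ | Equivalence.to 𝒞″⇔ B∈𝒞″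
  ... | a , a<t∸1 , refl | b , b<t∸1 , refl =
    C″-apart (<t∸1⇒<t a<t∸1) (<t∸1⇒<t b<t∸1) λ { refl → A≢B refl }
  𝒫-apart (inj₁ A∈𝒞′) (inj₂ B∈𝒞″) _ with Equivalence.to 𝒞′⇔ A∈𝒞′ | Equivalence.to 𝒞″⇔ B∈𝒞″
  ... | a , _ , refl | b , _ , refl = C′-C″-apart a b
  𝒫-apart (inj₂ A∈𝒞″) (inj₁ B∈𝒞′) _ with Equivalence.to 𝒞″⇔ A∈𝒞″ | Equivalence.to 𝒞′⇔ B∈𝒞′
  ... | a , a<t∸1 , refl | b , b<t , refl = C″-C′-apart (<t∸1⇒<t a<t∸1) b<t

  𝒫? : Decidable 𝒫
  𝒫? S = mapDec (⇔-sym 𝒞′⇔) (anyUpTo? (λ a → S ≟ˢ C′ a) t)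
     ⊎-dec mapDec (⇔-sym 𝒞″⇔) (anyUpTo? (λ a → S ≟ˢ C″ a) (t ∸ 1))

  isRankSparsePavingCircuitSet : IsRankSparsePavingCircuitSet (𝒞rt r t) r
  isRankSparsePavingCircuitSet =
    SparsePavingConstruction.isRankSparsePavingCircuitSet 𝒫 𝒫? 𝒫-size 𝒫-apart
      (≤-trans (s≤s z≤n) 2≤r) (≤-<-trans r≤2t (m<m+n (2 * t) z<s))
      (𝒞rt r t) (λ _ → mk⇔ assocˡ assocʳ)

proposition3p3 : (r t : ℕ) → 4 ≤ r → 3 ≤ t → r ≤ 2 * t ∸ 2 →
    IsRankSparsePavingCircuitSet (𝒞rt r t) r
proposition3p3 r t 4≤r 3≤t r≤2t∸2 =
  Construction.isRankSparsePavingCircuitSet r t {{>-nonZero (≤-trans (s≤s z≤n) 3≤t)}} 4≤r 2+r≤2t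
  where
  2+r≤2t : 2 + r ≤ 2 * t
  2+r≤2t = subst (2 + r ≤_) (m+[n∸m]≡n (*-monoʳ-≤ 2 (≤-trans (s≤s z≤n) 3≤t))) (+-monoʳ-≤ 2 r≤2t∸2)
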